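{- Suppose an adversary presents a bipartite graph $G$ to the algorithm described in the context. Let $v\in V(G)$, let $i\ge1$, and let $x,y$ be two vertices lying on opposite sides of $C_i[v]$, both colored $a_i$. Then $x$ and $y$ lie in different connected components of $C_i(v)$.
   Context: The algorithm uses three pairwise disjoint palettes of colors $\{a_n\}_{n\ge1}$, $\{b_n\}_{n\ge1}$, $\{c_n\}_{n\ge1}$. A vertex has color index $i$ if its color is $a_i$ or $b_i$. For a connected bipartite subgraph $C$, its sides are its two color classes; a color is mixed in $C$ if it is used on vertices of both sides of $C$. A vertex $u$ is universal to a subgraph $C$ if $u$ is adjacent to all vertices of one of the sides of $C$. When a vertex $v$ is presented, let $G_i[v]$ be the subgraph induced by $v$ together with all previously presented vertices colored with a color from $\{a_1,\dots,a_i,b_1,\dots,b_i,c_1,\dots,c_i\}$, let $C_i[v]$ be the connected component of $G_i[v]$ containing $v$, put $C_0[v]=\{v\}$, and let $C_i(v)$ be $C_i[v]$ with $v$ removed; for a vertex presented earlier, these graphs refer to the moment it was presented. The algorithm colors the new vertex $v$ as follows: let $m=\max\{i\ge1: a_i \text{ is mixed in } C_i[v]\}+1$ (with $\max\emptyset=0$); let $I_1,I_2$ be the sides of $C_m[v]$ with $v\in I_1$. If $a_m$ is used on a vertex of $I_2$, color $v$ with $b_m$; else if $c_m$ is used on a vertex of $I_2$, color $v$ with $a_m$; else if there exist $u\in I_1\cup I_2$ and $u'\in I_2$ such that $u$ has color index $j\ge m-\sqrt{2m}+2$ and $u'$ is universal to $C_{j-1}[u]$, color $v$ with $c_m$; otherwise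 color $v$ with $a_m$. -}

module Defs where

open import Data.Nat using (ℕ; zero; suc; _+_; _*_; _∸_; _^_; _≤_; _<_)
open import Data.Bool using (Bool; true; false; not)
open import Data.Product using (Σ; ∃; ∃-syntax; _×_; _,_)
open import Data.Sum using (_⊎_)
open import Data.Empty using (⊥)
open import Relation.Nullary using (¬_)
open import Relation.Binary.PropositionalEquality using (_≡_; _≢_)

-- The three pairwise disjoint palettes {a_n}, {b_n}, {c_n} (indices n ≥ 1 are used).
data Color : Set where
  a b c : ℕ → Color

idx : Color → ℕ
idx (a i) = i
idx (b i) = i
idx (c i) = i

InPalette : ℕ → Color → Set
InPalette i col = 1 ≤ idx col × idx col ≤ i

HasColorIndex : Color → ℕ → Set
HasColorIndex col j = col ≡ a j ⊎ col ≡ b j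

-- A finite simple bipartite graph on vertices 0,1,…,n-1, presented
-- in the order 0,1,…,n-1.
record BipartiteGraph : Set₁ where
  field
    n       : ℕ
    Adj     : ℕ → ℕ → Set
    sym     : ∀ {x y} → Adj x y → Adj y x
    irrefl  : ∀ {x} → ¬ Adj x x
    inV     : ∀ {x y} → Adj x y → x < n × y < n
    side    : ℕ → Bool
    proper  : ∀ {x y} → Adj x y → side x ≢ side y

module _ (G : BipartiteGraph) where
  open BipartiteGraph G

  -- Walks inside a vertex set S, indexed by the parity of their length
  -- (false = even, true = odd).
  data Walk (S : ℕ → Set) (x : ℕ) : ℕ → Bool → Set where
    here : S x → Walk S x x false
    step : ∀ {y z p} → Walk S x y p → Adj y z → S z → Walk S x z (not p)

  module _ (col : ℕ → Color) where

    -- vertex set of G_i[v]: v together with previously presented vertices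
    -- coloured from {a_1..a_i, b_1..b_i, c_1..c_i}
    VG : ℕ → ℕ → ℕ → Set
    VG i v u = u ≡ v ⊎ (u < v × InPalette i (col u))

    -- u ∈ C_i[v] on the side given by parity p (false: the side of v)
    SideOf : ℕ → ℕ → Bool → ℕ → Set
    SideOf i v p u = Walk (VG i v) v u p

    InC : ℕ → ℕ → ℕ → Set
    InC i v u = ∃[ p ] SideOf i v p u

    -- vertex set of C_i(v) = C_i[v] with v removed (v is the last vertex of G_i[v])
    VCminus : ℕ → ℕ → ℕ → Set
    VCminus i v u = u < v × InC i v u

    Mixed : ℕ → ℕ → Set
    Mixed i v = ∃[ x ] ∃[ y ] (x < v × y < v × col x ≡ a i × col y ≡ a i
                               × SideOf i v false x × SideOf i v true y)

    -- m = max{i ≥ 1 : a_i mixed in C_i[v]} + 1  (max ∅ = 0)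
    IsLevel : ℕ → ℕ → Set
    IsLevel v m = 1 ≤ m × (m ≡ 1 ⊎ Mixed (m ∸ 1) v) × (∀ i → m ≤ i → ¬ Mixed i v)

    Universal : ℕ → ℕ → ℕ → Set
    Universal u' k u = (∀ w → SideOf k u false w → Adj u' w)
                     ⊎ (∀ w → SideOf k u true w → Adj u' w)

    -- the four tests of the algorithm for vertex v at level m (I₂ = odd side)
    A₂ : ℕ → ℕ → Set
    A₂ v m = ∃[ u ] (u < v × col u ≡ a m × SideOf m v true u)

    C₂ : ℕ → ℕ → Set
    C₂ v m = ∃[ u ] (u < v × col u ≡ c m × SideOf m v true u)

    -- j ≥ m - √(2m) + 2  ⇔  ((m+2) ∸ j)² ≤ 2m   (exact integer form)
    Uc : ℕ → ℕ → Set
    Uc v m = ∃[ u ] ∃[ u' ] ∃[ j ]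
               (u < v × InC m v u × HasColorIndex (col u) j
                × ((m + 2) ∸ j) ^ 2 ≤ 2 * m
                × u' < v × SideOf m v true u'
                × Universal u' (j ∸ 1) u)

    AlgStep : ℕ → Set
    AlgStep v = ∃[ m ] (IsLevel v m ×
                  ( (A₂ v m × col v ≡ b m)
                  ⊎ (¬ A₂ v m × C₂ v m × col v ≡ a m)
                  ⊎ (¬ A₂ v m × ¬ C₂ v m × Uc v m × col v ≡ c m)
                  ⊎ (¬ A₂ v m × ¬ C₂ v m × ¬ Uc v m × col v ≡ a m)))

  IsAlgColoring : (ℕ → Color) → Set
  IsAlgColoring col = ∀ v → v < n → AlgStep col v

module Submission where

-- Suppose such a walk exists and let w be its latest presented vertex (its
-- "peak").  The walk splits at w into walks x → w and w → y through vertices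
-- presented no later than w.  Every vertex of C_i(v) carries a colour from the
-- first i palettes, so both pieces live in G_i[w]: x and y belong to C_i[w],
-- and, since sides are determined by the bipartition of G, still on opposite
-- sides.  Now look at what the algorithm did when w was presented:
--   * if w is x or y, then w was coloured a_i although an a_i-coloured vertex
--     lay on the opposite side of C_i[w] — the algorithm answers b_i there;
--   * otherwise a_i is mixed in C_i[w], so the level of w exceeds i, whereas
--     w, a vertex of C_i(v), has colour index at most i.

open import Defs
open import Data.Nat using (ℕ; _≤_; _<_)
open import Data.Nat.Properties using (≤-refl; ≤-trans; <⇒≤; <-trans; <-irrefl; _≤?_; ≰⇒>; m≤n⇒m<n∨m≡n)
open import Data.Bool using (Bool; true; false; not; _xor_)
open import Data.Bool.Properties using (¬-not; xor-assoc; xor-same; xor-identityʳ; not-distribˡ-xor)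
open import Data.Product using (∃-syntax; _×_; _,_; proj₁; proj₂)
open import Data.Sum using (inj₁; inj₂)
open import Data.Empty using (⊥; ⊥-elim)
open import Relation.Nullary using (¬_; yes; no)
open import Relation.Binary.PropositionalEquality using (_≡_; refl; sym; trans; cong; subst; module ≡-Reasoning)

xor-cancelʳ : ∀ x z → (x xor z) xor z ≡ x
xor-cancelʳ x z = trans (xor-assoc x z z) (trans (cong (x xor_) (xor-same z)) (xor-identityʳ x))

module Walks (G : BipartiteGraph) where
  open BipartiteGraph G renaming (sym to adj-sym)

  Connected : (ℕ → Set) → ℕ → ℕ → Set
  Connected S x y = ∃[ q ] Walk G S x y q

  Below : (ℕ → Set) → ℕ → ℕ → Set
  Below S w u = S u × u ≤ w

  walkStart : ∀ {S x y q} → Walk G S x y q → S x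
  walkStart (here s)     = s
  walkStart (step w _ _) = walkStart w

  walkEnd : ∀ {S x y q} → Walk G S x y q → S y
  walkEnd (here s)     = s
  walkEnd (step _ _ s) = s

  mapWalk : ∀ {S T : ℕ → Set} {x y q} → (∀ {u} → S u → T u) → Walk G S x y q → Walk G T x y q
  mapWalk f (here s)     = here (f s)
  mapWalk f (step w e s) = step (mapWalk f w) e (f s)

  consWalk : ∀ {S x y z q} → S x → Adj x y → Walk G S y z q → Walk G S x z (not q)
  consWalk sx e (here sy)       = step (here sx) e sy
  consWalk sx e (step w e′ sz) = step (consWalk sx e w) e′ sz

  reverseWalk : ∀ {S x y q} → Walk G S x y q → Walk G S y x q
  reverseWalk (here s)      = here s
  reverseWalk (step w e sz) = consWalk sz (adj-sym e) (reverseWalk w)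

  appendWalk : ∀ {S x y z q r} → Walk G S x y q → Walk G S y z r → Connected S x z
  appendWalk w (here _) = _ , w
  appendWalk w (step w′ e sz) with appendWalk w w′
  ... | _ , w″ = _ , step w″ e sz

  parity-from-sides : ∀ {S x y q} → Walk G S x y q → q ≡ side y xor side x
  parity-from-sides {x = x} (here _) = sym (xor-same (side x))
  parity-from-sides {x = x} (step {y = y} {z = z} {p = p} w e _) = begin
    not p                    ≡⟨ cong not (parity-from-sides w) ⟩
    not (side y xor side x)  ≡⟨ not-distribˡ-xor (side y) (side x) ⟩
    not (side y) xor side x  ≡⟨ cong (_xor side x) (sym (¬-not (λ z≡y → proper e (sym z≡y)))) ⟩
    side z xor side x        ∎
    where open ≡-Reasoning

  closed-walk-even : ∀ {S x q} → Walk G S x x q → q ≡ false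
  closed-walk-even {x = x} w = trans (parity-from-sides w) (xor-same (side x))

  sides-of-opposite-parities : ∀ {S T s x y p} → Walk G S s x p → Walk G T s y (not p) →
                               side y ≡ not (side x)
  sides-of-opposite-parities {s = s} {x} {y} {p} wx wy = begin
    side y                              ≡⟨ sym (xor-cancelʳ (side y) (side s)) ⟩
    (side y xor side s) xor side s      ≡⟨ cong (_xor side s) (sym (parity-from-sides wy)) ⟩
    not p xor side s                    ≡⟨ cong (λ t → not t xor side s) (parity-from-sides wx) ⟩
    not (side x xor side s) xor side s  ≡⟨ cong (_xor side s) (not-distribˡ-xor (side x) (side s)) ⟩
    (not (side x) xor side s) xor side s ≡⟨ xor-cancelʳ (not (side x)) (side s) ⟩
    not (side x)                        ∎
    where open ≡-Reasoning

  parities-of-opposite-sides : ∀ {S T s x y p p′} → Walk G S s x p → Walk G T s y p′ →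
                               side y ≡ not (side x) → p′ ≡ not p
  parities-of-opposite-sides {s = s} {x} {y} {p} {p′} wx wy y-opp-x = begin
    p′                      ≡⟨ parity-from-sides wy ⟩
    side y xor side s       ≡⟨ cong (_xor side s) y-opp-x ⟩
    not (side x) xor side s ≡⟨ sym (not-distribˡ-xor (side x) (side s)) ⟩
    not (side x xor side s) ≡⟨ cong not (sym (parity-from-sides wx)) ⟩
    not p                   ∎
    where open ≡-Reasoning

  -- Peak decomposition: every walk x → z in S passes through a vertex w such
  -- that both pieces x → w and w → z use only vertices of S presented no later
  -- than w.  (Induction on the walk, tracking its maximal vertex.)
  peak : ∀ {S x z q} → Walk G S x z q →
         ∃[ w ] (Connected (Below S w) x w × Connected (Below S w) w z)
  peak (here sx) = _ , (_ , here (sx , ≤-refl)) , (_ , here (sx , ≤-refl))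
  peak {S} {z = z} (step W e sz) with peak W
  ... | w , (_ , pre) , (_ , suf) with z ≤? w
  ...   | yes z≤w = w , (_ , pre) , (_ , step suf e (sz , z≤w))
  ...   | no  z≰w = z , (_ , step (mapWalk raise (proj₂ (appendWalk pre suf))) e (sz , ≤-refl))
                      , (_ , here (sz , ≤-refl))
    where
    raise : ∀ {u} → Below S w u → Below S z u
    raise (s , u≤w) = s , ≤-trans u≤w (<⇒≤ (≰⇒> z≰w))

module Algorithm (G : BipartiteGraph) (col : ℕ → Color) where
  open Walks G

  -- Every vertex of C_i(v) carries a colour from the first i palettes: it is a
  -- vertex of G_i[v] other than v.
  C⁻-palette : ∀ {i v u} → VCminus G col i v u → InPalette i (col u)
  C⁻-palette (u<v , _ , wu) with walkEnd wu
  ... | inj₁ refl      = ⊥-elim (<-irrefl refl u<v)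
  ... | inj₂ (_ , pal) = pal

  C⁻-below⇒G : ∀ {i v w u} → Below (VCminus G col i v) w u → VG G col i w u
  C⁻-below⇒G (u∈C⁻ , u≤w) with m≤n⇒m<n∨m≡n u≤w
  ... | inj₁ u<w = inj₂ (u<w , C⁻-palette u∈C⁻)
  ... | inj₂ u≡w = inj₁ u≡w

  -- A vertex coloured a_k saw no a_k-coloured vertex on the far side of C_k[w]
  -- when it was presented (otherwise the algorithm would have chosen b_k).
  a-coloured⇒¬A₂ : ∀ {w k} → AlgStep G col w → col w ≡ a k → ¬ A₂ G col w k
  a-coloured⇒¬A₂ (_ , _ , inj₁ (_ , cw)) cw′ with trans (sym cw′) cw
  ... | ()
  a-coloured⇒¬A₂ (_ , _ , inj₂ (inj₁ (¬A , _ , cw))) cw′ with trans (sym cw′) cw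
  ... | refl = ¬A
  a-coloured⇒¬A₂ (_ , _ , inj₂ (inj₂ (inj₁ (_ , _ , _ , cw)))) cw′ with trans (sym cw′) cw
  ... | ()
  a-coloured⇒¬A₂ (_ , _ , inj₂ (inj₂ (inj₂ (¬A , _ , _ , cw)))) cw′ with trans (sym cw′) cw
  ... | refl = ¬A

  index≡level : ∀ {w} (alg : AlgStep G col w) → idx (col w) ≡ proj₁ alg
  index≡level (_ , _ , inj₁ (_ , cw))                      = cong idx cw
  index≡level (_ , _ , inj₂ (inj₁ (_ , _ , cw)))           = cong idx cw
  index≡level (_ , _ , inj₂ (inj₂ (inj₁ (_ , _ , _ , cw)))) = cong idx cw
  index≡level (_ , _ , inj₂ (inj₂ (inj₂ (_ , _ , _ , cw)))) = cong idx cw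

  -- Since a_i is not mixed in C_i[w] for i at or above the level of w, it is
  -- not mixed for any i at or above the colour index of w.
  unmixed-from-index : ∀ {w i} → AlgStep G col w → idx (col w) ≤ i → ¬ Mixed G col i w
  unmixed-from-index {i = i} alg@(_ , (_ , _ , unmixed) , _) idx≤i =
    unmixed i (subst (_≤ i) (index≡level alg) idx≤i)

  -- Two a_i-coloured vertices presented no later than w cannot lie on the
  -- even and the odd side of C_i[w] when the colour index of w is at most i:
  -- the odd one is not w itself (closed walks are even); if the even one is w,
  -- the algorithm would not have coloured w with a_i; otherwise a_i is mixed.
  no-aᵢ-pair-even-odd : ∀ {w i x y} → AlgStep G col w → idx (col w) ≤ i →
                        x ≤ w → y ≤ w → col x ≡ a i → col y ≡ a i →
                        SideOf G col i w false x → SideOf G col i w true y → ⊥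
  no-aᵢ-pair-even-odd alg idx≤i x≤w y≤w cx cy wx wy with m≤n⇒m<n∨m≡n y≤w | m≤n⇒m<n∨m≡n x≤w
  ... | inj₂ refl | _ with closed-walk-even wy
  ...   | ()
  no-aᵢ-pair-even-odd alg idx≤i x≤w y≤w cx cy wx wy
      | inj₁ y<w  | inj₂ refl = a-coloured⇒¬A₂ alg cx (_ , y<w , cy , wy)
  no-aᵢ-pair-even-odd alg idx≤i x≤w y≤w cx cy wx wy
      | inj₁ y<w  | inj₁ x<w  = unmixed-from-index alg idx≤i (_ , _ , x<w , y<w , cx , cy , wx , wy)

  no-aᵢ-pair-across : ∀ {w i x y} (p : Bool) → AlgStep G col w → idx (col w) ≤ i →
                      x ≤ w → y ≤ w → col x ≡ a i → col y ≡ a i →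
                      SideOf G col i w p x → SideOf G col i w (not p) y → ⊥
  no-aᵢ-pair-across false alg idx≤i x≤w y≤w cx cy wx wy = no-aᵢ-pair-even-odd alg idx≤i x≤w y≤w cx cy wx wy
  no-aᵢ-pair-across true  alg idx≤i x≤w y≤w cx cy wx wy = no-aᵢ-pair-even-odd alg idx≤i y≤w x≤w cy cx wy wx

claim5 : (G : BipartiteGraph) → (col : ℕ → Color) → IsAlgColoring G col →
         (v : ℕ) → v < BipartiteGraph.n G → (i : ℕ) → 1 ≤ i →
         (x y : ℕ) → x < v → y < v → (p : Bool) →
         SideOf G col i v p x → SideOf G col i v (not p) y →
         col x ≡ a i → col y ≡ a i →
         ¬ (∃[ q ] Walk G (VCminus G col i v) x y q)
claim5 G col alg v v<n i _ x y _ _ _ v⇝x v⇝y cx cy (_ , x⇝y) = split-at (peak x⇝y)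
  where
  open Walks G
  open Algorithm G col

  C⁻ : ℕ → Set
  C⁻ = VCminus G col i v

  split-at : ∃[ w ] (Connected (Below C⁻ w) x w × Connected (Below C⁻ w) w y) → ⊥
  split-at (w , (q , x⇝w) , (_ , w⇝y)) =
    no-aᵢ-pair-across q (alg w w<n) (proj₂ (C⁻-palette w∈C⁻)) x≤w y≤w cx cy w⇝ᵢx w⇝ᵢy
    where
    w∈C⁻ : C⁻ w
    w∈C⁻ = proj₁ (walkEnd x⇝w)
    w<n : w < BipartiteGraph.n G
    w<n = <-trans (proj₁ w∈C⁻) v<n
    x≤w : x ≤ w
    x≤w = proj₂ (walkStart x⇝w)
    y≤w : y ≤ w
    y≤w = proj₂ (walkEnd w⇝y)
    -- both pieces lie in G_i[w], so x and y belong to C_i[w] ...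
    w⇝ᵢx : SideOf G col i w q x
    w⇝ᵢx = reverseWalk (mapWalk C⁻-below⇒G x⇝w)
    y∈Cᵢ[w] : Connected (VG G col i w) w y
    y∈Cᵢ[w] = _ , mapWalk C⁻-below⇒G w⇝y
    -- ... on opposite sides, as they are on opposite sides of C_i[v]
    w⇝ᵢy : SideOf G col i w (not q) y
    w⇝ᵢy = subst (λ r → SideOf G col i w r y)
                 (parities-of-opposite-sides w⇝ᵢx (proj₂ y∈Cᵢ[w]) (sides-of-opposite-parities v⇝x v⇝y))
                 (proj₂ y∈Cᵢ[w])
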